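{- Let $n\ge 4$ and let $C_n$ be the cycle of order $n$. Then $\gamma_{\times 2,t}^{r}(C_n)=n$ and $$\gamma_{t}^{r}(C_n)=\begin{cases} 2\lceil n/4\rceil-1 & \text{if } n\equiv 1 \pmod 4,\\ 2\lceil n/4\rceil+1 & \text{if } n\equiv 3 \pmod 4,\\ 2\lceil n/4\rceil & \text{otherwise.}\end{cases}$$
   Context: All graphs are finite and simple; $N(x)$ denotes the open neighborhood of $x$. For an integer $k\ge 1$, a set $S\subseteq V(G)$ is a $k$-tuple total dominating set of $G$ if $|N(x)\cap S|\ge k$ for every $x\in V(G)$. It is a $k$-tuple total restrained dominating set (kTRDS) if moreover every vertex $x\in V(G)\setminus S$ is adjacent to at least $k$ vertices of $V(G)\setminus S$. For a graph with minimum degree at least $k$, $\gamma_{\times k,t}^{r}(G)$ denotes the minimum cardinality of a kTRDS of $G$; $\gamma_t^r(G)=\gamma_{\times 1,t}^{r}(G)$. -}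

module Defs where

open import Data.Nat using (ℕ; zero; suc; _+_; _*_; _∸_; _≤_; _≥_; NonZero)
open import Data.Nat.DivMod using (_%_; _/_)
open import Data.Fin using (Fin; toℕ)
open import Data.Fin.Subset using (Subset; _∈_; _∉_; ∣_∣)
open import Data.Fin.Subset.Properties using (_∈?_)
open import Data.List using (List; length; filter; allFin)
open import Data.Product using (_×_; Σ)
open import Relation.Nullary using (¬_; Dec)
open import Relation.Nullary.Decidable using (_×-dec_; _⊎-dec_)
open import Data.Sum using (_⊎_)
open import Data.Nat.Properties using (_≟_)
open import Relation.Binary.PropositionalEquality using (_≡_)

-- A graph on vertex set Fin n given by a decidable adjacency relation.
-- (Only the cycle is used; its adjacency is symmetric and, for n ≥ 3, irreflexive.)
record Graph (n : ℕ) : Set₁ where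
  field
    Adj     : Fin n → Fin n → Set
    adj?    : (x y : Fin n) → Dec (Adj x y)

open Graph public

degIn : ∀ {n} (G : Graph n) → Fin n → Subset n → ℕ
degIn {n} G x S = length (filter (λ y → adj? G x y ×-dec (y ∈? S)) (allFin n))

degOut : ∀ {n} (G : Graph n) → Fin n → Subset n → ℕ
degOut {n} G x S = length (filter (λ y → adj? G x y ×-dec Relation.Nullary.¬? (y ∈? S)) (allFin n))

minDegAtLeast : ∀ {n} → Graph n → ℕ → Set
minDegAtLeast {n} G k = ∀ (x : Fin n) → k ≤ length (filter (adj? G x) (allFin n))

IsKTRDS : ∀ {n} → Graph n → ℕ → Subset n → Set
IsKTRDS {n} G k S =
  (∀ (x : Fin n) → k ≤ degIn G x S) ×
  (∀ (x : Fin n) → x ∉ S → k ≤ degOut G x S)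

IsGammaKTR : ∀ {n} → Graph n → ℕ → ℕ → Set
IsGammaKTR G k m =
  Σ _ (λ S → IsKTRDS G k S × ∣ S ∣ ≡ m) × (∀ S → IsKTRDS G k S → m ≤ ∣ S ∣)

CycleAdj : (n : ℕ) .{{_ : NonZero n}} → Fin n → Fin n → Set
CycleAdj n x y = (suc (toℕ x) % n ≡ toℕ y) ⊎ (suc (toℕ y) % n ≡ toℕ x)

Cycle : (n : ℕ) .{{_ : NonZero n}} → Graph n
Cycle n = record
  { Adj  = CycleAdj n
  ; adj? = λ x y → (suc (toℕ x) % n ≟ toℕ y) ⊎-dec (suc (toℕ y) % n ≟ toℕ x)
  }

nz4 : ∀ {n} → 4 ≤ n → NonZero n
nz4 (Data.Nat.s≤s _) = _

ceil4 : ℕ → ℕ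
ceil4 n = (n + 3) / 4

gammaTRCycle : ℕ → ℕ
gammaTRCycle n with n % 4
... | 1 = 2 * ceil4 n ∸ 1
... | 3 = 2 * ceil4 n + 1
... | _ = 2 * ceil4 n

-- Read a vertex set S of C_n as a Boolean necklace. If S is a 1-tuple total restrained dominating set,
-- every vertex outside S has a neighbour in S (total domination) and one outside S (restraint), so it lies
-- on exactly one edge with both ends outside S; counting these e edges gives |S| + 2e = n. Total domination
-- of the two vertices following such an edge puts them in S, so outside edges start at least four steps
-- apart and 4e ≤ n. Hence |S| ≥ n - 2⌊n/4⌋ = 2⌊n/4⌋ + (n mod 4), the claimed value, which the necklace
-- 1100 1100 … 1100 1…1 attains. For k = 2 each vertex is a neighbour of its successor, whose two neighbours
-- must both lie in S, so S is the whole vertex set.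

module Submission where

open import Defs
open import Data.Bool using (Bool; true; false; T; not; _∧_; _∨_)
open import Data.Bool.Properties using (T-≡; T-∨; T-∧; ¬-not)
open import Data.Empty using (⊥-elim)
open import Data.Fin using (Fin; zero; suc; toℕ; fromℕ; fromℕ<; inject₁)
open import Data.Fin.Permutation using (Permutation′; permutation)
open import Data.Fin.Properties using (toℕ-injective; toℕ-fromℕ<; toℕ-fromℕ; toℕ-inject₁; toℕ<n)
open import Data.Fin.Subset using (Subset; _∈_; _∉_; ∣_∣; ⊤)
open import Data.Fin.Subset.Properties using (_∈?_; ∈⊤; ∣⊤∣≡n; p⊆q⇒∣p∣≤∣q∣)
open import Data.List using (List; []; _∷_; length; filter; allFin)
open import Data.List.Membership.Propositional using () renaming (_∈_ to _∈ˡ_)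
open import Data.List.Membership.Propositional.Properties using (∈-filter⁺; ∈-filter⁻; ∈-allFin; ∈-length)
open import Data.List.Relation.Unary.All using (_∷_)
open import Data.List.Relation.Unary.AllPairs using (_∷_)
open import Data.List.Relation.Unary.Any using (here; there)
open import Data.List.Relation.Unary.Unique.Propositional using (Unique)
open import Data.List.Relation.Unary.Unique.Propositional.Properties using (filter⁺; allFin⁺)
open import Data.Nat using (ℕ; zero; suc; _+_; _*_; _∸_; _≤_; _<_; z≤n; s≤s)
open import Data.Nat.Divisibility using (divides)
open import Data.Nat.DivMod
  using (_%_; _/_; m%n<n; m<n⇒m%n≡m; n%n≡0; m≡m%n+[m/n]*n; [m+kn]%n≡m%n; m*n/n≡m; m/n*n≤m; /-monoˡ-≤; /-congˡ; +-distrib-/-∣ʳ)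
open import Data.Nat.Properties
open import Algebra.Properties.CommutativeMonoid.Sum +-0-commutativeMonoid
  using (sum; sum-syntax; sum-cong-≗; ∑-distrib-+; sum-permute)
open import Data.Nat.Tactic.RingSolver using (solve-∀)
open import Data.Product using (_×_; _,_; ∃-syntax; proj₁; proj₂)
open import Data.Sum using (_⊎_; inj₁; inj₂)
open import Data.Vec using ([]; _∷_; lookup; tabulate)
open import Data.Vec.Properties using ([]=⇒lookup; lookup⇒[]=; lookup∘tabulate)
open import Function using (_∘_; Equivalence)
open import Relation.Binary.PropositionalEquality
open import Relation.Nullary using (¬?; yes; no; _×-dec_)
open import Relation.Unary using (Decidable)

module _ {A : Set} where

  1≤length⇒∈ : {xs : List A} → 1 ≤ length xs → ∃[ x ] x ∈ˡ xs
  1≤length⇒∈ {x ∷ _} _ = x , here refl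

  ∈-∈-≢⇒2≤length : {x y : A} {xs : List A} → x ∈ˡ xs → y ∈ˡ xs → x ≢ y → 2 ≤ length xs
  ∈-∈-≢⇒2≤length (here refl) (here refl)  x≢y = ⊥-elim (x≢y refl)
  ∈-∈-≢⇒2≤length (here refl) (there y∈)   _   = s≤s (∈-length y∈)
  ∈-∈-≢⇒2≤length (there x∈)  (here refl)  _   = s≤s (∈-length x∈)
  ∈-∈-≢⇒2≤length (there x∈)  (there y∈)   x≢y = m≤n⇒m≤1+n (∈-∈-≢⇒2≤length x∈ y∈ x≢y)

  unique-constant⇒length≤1 : {c : A} {xs : List A} → Unique xs → (∀ {y} → y ∈ˡ xs → y ≡ c) → length xs ≤ 1
  unique-constant⇒length≤1 {xs = []}         _                _     = z≤n
  unique-constant⇒length≤1 {xs = _ ∷ []}     _                _     = s≤s z≤n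
  unique-constant⇒length≤1 {xs = _ ∷ _ ∷ _} ((x≢y ∷ _) ∷ _) const =
    ⊥-elim (x≢y (trans (const (here refl)) (sym (const (there (here refl))))))

module _ {k : ℕ} where

  next : Fin (suc k) → Fin (suc k)
  next x = fromℕ< (m%n<n (suc (toℕ x)) (suc k))

  prev : Fin (suc k) → Fin (suc k)
  prev zero    = fromℕ k
  prev (suc i) = inject₁ i

  toℕ-next : (x : Fin (suc k)) → toℕ (next x) ≡ suc (toℕ x) % suc k
  toℕ-next x = toℕ-fromℕ< (m%n<n (suc (toℕ x)) (suc k))

  toℕ-next-< : (x : Fin (suc k)) → suc (toℕ x) < suc k → toℕ (next x) ≡ suc (toℕ x)
  toℕ-next-< x lt = trans (toℕ-next x) (m<n⇒m%n≡m lt)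

  toℕ-next-last : (x : Fin (suc k)) → suc (toℕ x) ≡ suc k → toℕ (next x) ≡ 0
  toℕ-next-last x eq = trans (toℕ-next x) (trans (cong (_% suc k) eq) (n%n≡0 (suc k)))

  toℕ-prev-suc : (y : Fin (suc k)) {j : ℕ} → toℕ y ≡ suc j → toℕ (prev y) ≡ j
  toℕ-prev-suc (suc i) eq = trans (toℕ-inject₁ i) (suc-injective eq)

  next-prev : (x : Fin (suc k)) → next (prev x) ≡ x
  next-prev zero    = toℕ-injective (toℕ-next-last (fromℕ k) (cong suc (toℕ-fromℕ k)))
  next-prev (suc i) = toℕ-injective (trans (toℕ-next-< (inject₁ i) lt) (cong suc (toℕ-inject₁ i)))
    where
    lt : suc (toℕ (inject₁ i)) < suc k
    lt = s≤s (subst (_< k) (sym (toℕ-inject₁ i)) (toℕ<n i))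

  prev-next : (x : Fin (suc k)) → prev (next x) ≡ x
  prev-next x with m≤n⇒m<n∨m≡n (toℕ<n x)
  ... | inj₁ lt   = toℕ-injective (toℕ-prev-suc (next x) (toℕ-next-< x lt))
  ... | inj₂ last rewrite toℕ-injective {i = next x} {j = zero} (toℕ-next-last x last) =
    toℕ-injective (trans (toℕ-fromℕ k) (sym (suc-injective last)))

  next-permutation : Permutation′ (suc k)
  next-permutation = permutation next prev next-prev prev-next

  sum-next : (f : Fin (suc k) → ℕ) → sum (f ∘ next) ≡ sum f
  sum-next f = sym (sum-permute f next-permutation)

  sum-prev : (f : Fin (suc k) → ℕ) → sum (f ∘ prev) ≡ sum f
  sum-prev f = trans (sym (sum-next (f ∘ prev))) (sum-cong-≗ (cong f ∘ prev-next))

  cycleAdj⇒next⊎prev : (x y : Fin (suc k)) → CycleAdj (suc k) x y → y ≡ next x ⊎ y ≡ prev x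
  cycleAdj⇒next⊎prev x y (inj₁ eq) = inj₁ (toℕ-injective (trans (sym eq) (sym (toℕ-next x))))
  cycleAdj⇒next⊎prev x y (inj₂ eq) =
    inj₂ (trans (sym (prev-next y)) (cong prev (toℕ-injective (trans (toℕ-next y) eq))))

  cycleAdj-next : (x : Fin (suc k)) → CycleAdj (suc k) x (next x)
  cycleAdj-next x = inj₁ (sym (toℕ-next x))

  cycleAdj-prev : (x : Fin (suc k)) → CycleAdj (suc k) x (prev x)
  cycleAdj-prev x = inj₂ (trans (sym (toℕ-next (prev x))) (cong toℕ (next-prev x)))

  module _ (x : Fin (suc k)) {Q : Fin (suc k) → Set} (Q? : Decidable Q) where

    adjacentWith? : Decidable (λ y → CycleAdj (suc k) x y × Q y)
    adjacentWith? y = adj? (Cycle (suc k)) x y ×-dec Q? y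

    -- degIn (Cycle (suc k)) x S and degOut (Cycle (suc k)) x S are, by definition, the lengths of
    -- neighboursWith x (_∈? S) and neighboursWith x (¬? ∘ (_∈? S)).
    neighboursWith : List (Fin (suc k))
    neighboursWith = filter adjacentWith? (allFin (suc k))

    ∈-neighboursWith⁻ : ∀ {y} → y ∈ˡ neighboursWith → (y ≡ next x ⊎ y ≡ prev x) × Q y
    ∈-neighboursWith⁻ {y} y∈ with (adj , qy) ← proj₂ (∈-filter⁻ adjacentWith? {xs = allFin (suc k)} y∈) =
      cycleAdj⇒next⊎prev x y adj , qy

    ∈-neighboursWith⁺ : ∀ {y} → CycleAdj (suc k) x y → Q y → y ∈ˡ neighboursWith
    ∈-neighboursWith⁺ {y} adj qy = ∈-filter⁺ adjacentWith? (∈-allFin y) (adj , qy)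

    neighboursWith-nonempty⇒ : 1 ≤ length neighboursWith → Q (next x) ⊎ Q (prev x)
    neighboursWith-nonempty⇒ pos with (y , y∈) ← 1≤length⇒∈ pos | ∈-neighboursWith⁻ y∈
    ... | inj₁ refl , qy = inj₁ qy
    ... | inj₂ refl , qy = inj₂ qy

    neighboursWith-nonempty⇐ : ∀ {y} → CycleAdj (suc k) x y → Q y → 1 ≤ length neighboursWith
    neighboursWith-nonempty⇐ adj qy = ∈-length (∈-neighboursWith⁺ adj qy)

    neighboursWith-≥2⇒prev : 2 ≤ length neighboursWith → Q (prev x)
    neighboursWith-≥2⇒prev two with Q? (prev x)
    ... | yes qp = qp
    ... | no ¬qp = ⊥-elim (<⇒≱ two (unique-constant⇒length≤1 unique only-next))
      where
      unique : Unique neighboursWith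
      unique = filter⁺ adjacentWith? (allFin⁺ (suc k))
      only-next : ∀ {y} → y ∈ˡ neighboursWith → y ≡ next x
      only-next y∈ with ∈-neighboursWith⁻ y∈
      ... | inj₁ y≡next , _  = y≡next
      ... | inj₂ refl    , qy = ⊥-elim (¬qp qy)

    neighboursWith-≥2⇐ : next x ≢ prev x → Q (next x) → Q (prev x) → 2 ≤ length neighboursWith
    neighboursWith-≥2⇐ next≢prev qn qp = ∈-∈-≢⇒2≤length
      (∈-neighboursWith⁺ (cycleAdj-next x) qn) (∈-neighboursWith⁺ (cycleAdj-prev x) qp) next≢prev

next≢prev : ∀ {k} (x : Fin (3 + k)) → next x ≢ prev x
next≢prev {k} zero eq =
  0≢1+n (suc-injective (trans (sym (toℕ-next-< {2 + k} zero (s≤s (s≤s z≤n))))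
                              (trans (cong toℕ eq) (toℕ-fromℕ (2 + k)))))
next≢prev {k} (suc i) eq with m≤n⇒m<n∨m≡n (toℕ<n (suc i))
... | inj₁ lt   = m≢1+n+m (toℕ i) {1} (sym (trans (sym (toℕ-next-< (suc i) lt))
                                              (trans (cong toℕ eq) (toℕ-inject₁ i))))
... | inj₂ last = 0≢1+n (trans (sym (toℕ-next-last (suc i) last))
                               (trans (cong toℕ eq) (trans (toℕ-inject₁ i) (suc-injective (suc-injective last)))))

-- Outside edges of a total restrained dominating set
⟦_⟧ : Bool → ℕ
⟦ true  ⟧ = 1
⟦ false ⟧ = 0

⟦b⟧+⟦not-b⟧≡1 : ∀ b → ⟦ b ⟧ + ⟦ not b ⟧ ≡ 1
⟦b⟧+⟦not-b⟧≡1 true  = refl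
⟦b⟧+⟦not-b⟧≡1 false = refl

∑1≡n : ∀ n → ∑[ i < n ] 1 ≡ n
∑1≡n zero    = refl
∑1≡n (suc n) = cong suc (∑1≡n n)

sum-mono-≤ : ∀ {n} {f g : Fin n → ℕ} → (∀ i → f i ≤ g i) → sum f ≤ sum g
sum-mono-≤ {zero}  f≤g = z≤n
sum-mono-≤ {suc n} f≤g = +-mono-≤ (f≤g zero) (sum-mono-≤ (f≤g ∘ suc))

∣p∣≡∑⟦p[i]⟧ : ∀ {n} (p : Subset n) → ∣ p ∣ ≡ ∑[ i < n ] ⟦ lookup p i ⟧
∣p∣≡∑⟦p[i]⟧ []          = refl
∣p∣≡∑⟦p[i]⟧ (true  ∷ p) = cong suc (∣p∣≡∑⟦p[i]⟧ p)
∣p∣≡∑⟦p[i]⟧ (false ∷ p) = ∣p∣≡∑⟦p[i]⟧ p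

∑-distrib-+₄ : ∀ {n} (f g h l : Fin n → ℕ) →
  ∑[ i < n ] (f i + (g i + (h i + l i))) ≡ sum f + (sum g + (sum h + sum l))
∑-distrib-+₄ f g h l = trans (∑-distrib-+ f _) (cong (sum f +_)
  (trans (∑-distrib-+ g _) (cong (sum g +_) (∑-distrib-+ h l))))

outside-on-one-outside-edge : ∀ a b c → T (a ∨ c) → (T (a ∧ c) → T b) →
  ⟦ not b ⟧ ≡ ⟦ not (a ∨ b) ⟧ + ⟦ not (b ∨ c) ⟧
outside-on-one-outside-edge true  true  _     _  _      = refl
outside-on-one-outside-edge true  false true  _  closed = ⊥-elim (closed _)
outside-on-one-outside-edge true  false false _  _      = refl
outside-on-one-outside-edge false true  _     _  _      = refl
outside-on-one-outside-edge false false true  _  _      = refl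
outside-on-one-outside-edge false _     false () _

outside-edges-4-apart : ∀ b₀ b₁ b₂ b₃ b₄ → T (b₀ ∨ b₂) → T (b₁ ∨ b₃) → T (b₂ ∨ b₄) →
  ⟦ not (b₀ ∨ b₁) ⟧ + (⟦ not (b₁ ∨ b₂) ⟧ + (⟦ not (b₂ ∨ b₃) ⟧ + ⟦ not (b₃ ∨ b₄) ⟧)) ≤ 1
outside-edges-4-apart false false true  true  _     _  _  _  = s≤s z≤n
outside-edges-4-apart false true  true  true  _     _  _  _  = z≤n
outside-edges-4-apart false true  true  false true  _  _  _  = z≤n
outside-edges-4-apart false true  true  false false _  _  _  = s≤s z≤n
outside-edges-4-apart true  false false true  _     _  _  _  = s≤s z≤n
outside-edges-4-apart true  false true  true  _     _  _  _  = z≤n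
outside-edges-4-apart true  true  false false true  _  _  _  = s≤s z≤n
outside-edges-4-apart true  true  false true  _     _  _  _  = z≤n
outside-edges-4-apart true  true  true  false true  _  _  _  = z≤n
outside-edges-4-apart true  true  true  false false _  _  _  = s≤s z≤n
outside-edges-4-apart true  true  true  true  _     _  _  _  = z≤n
outside-edges-4-apart false _     false _     _     () _  _
outside-edges-4-apart _     false _     false _     _  () _
outside-edges-4-apart _     _     false _     false _  _  ()

outsideEdge : ∀ {k} → (Fin (suc k) → Bool) → Fin (suc k) → ℕ
outsideEdge b i = ⟦ not (b i ∨ b (next i)) ⟧

module _ {k : ℕ} (b : Fin (suc k) → Bool)
         (dominated : ∀ x → T (b (prev x) ∨ b (next x)))
         (closed : ∀ x → T (b (prev x) ∧ b (next x)) → T (b x)) where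

  private
    e : ℕ
    e = sum (outsideEdge b)

  ∑⟦b⟧+2*outsideEdges≡n : sum (⟦_⟧ ∘ b) + (e + e) ≡ suc k
  ∑⟦b⟧+2*outsideEdges≡n = begin
    sum (⟦_⟧ ∘ b) + (e + e)
      ≡⟨ cong (λ e′ → sum (⟦_⟧ ∘ b) + (e′ + e)) (sym (sum-prev (outsideEdge b))) ⟩
    sum (⟦_⟧ ∘ b) + (sum (outsideEdge b ∘ prev) + e)
      ≡⟨ cong (sum (⟦_⟧ ∘ b) +_) (sym (∑-distrib-+ (outsideEdge b ∘ prev) (outsideEdge b))) ⟩
    sum (⟦_⟧ ∘ b) + ∑[ i < suc k ] (outsideEdge b (prev i) + outsideEdge b i)
      ≡⟨ cong (sum (⟦_⟧ ∘ b) +_) (sum-cong-≗ (sym ∘ ⟦not-b⟧≡edges)) ⟩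
    sum (⟦_⟧ ∘ b) + ∑[ i < suc k ] ⟦ not (b i) ⟧
      ≡⟨ sym (∑-distrib-+ (⟦_⟧ ∘ b) (⟦_⟧ ∘ not ∘ b)) ⟩
    ∑[ i < suc k ] (⟦ b i ⟧ + ⟦ not (b i) ⟧)
      ≡⟨ sum-cong-≗ (⟦b⟧+⟦not-b⟧≡1 ∘ b) ⟩
    ∑[ i < suc k ] 1
      ≡⟨ ∑1≡n (suc k) ⟩
    suc k ∎
    where
    open ≡-Reasoning
    ⟦not-b⟧≡edges : ∀ i → ⟦ not (b i) ⟧ ≡ outsideEdge b (prev i) + outsideEdge b i
    ⟦not-b⟧≡edges i = trans
      (outside-on-one-outside-edge (b (prev i)) (b i) (b (next i)) (dominated i) (closed i))
      (cong (λ y → ⟦ not (b (prev i) ∨ b y) ⟧ + outsideEdge b i) (sym (next-prev i)))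

  4*outsideEdges≤n : 4 * e ≤ suc k
  4*outsideEdges≤n = begin
    4 * e
      ≡⟨ cong (λ e′ → e + (e + (e + e′))) (+-identityʳ e) ⟩
    e + (e + (e + e))
      ≡⟨ sym (cong₂ (λ e₁ e₂₃ → e + (e₁ + e₂₃)) rotated₁ (cong₂ _+_ rotated₂ rotated₃)) ⟩
    sum w + (sum (w ∘ next) + (sum (w ∘ next ∘ next) + sum (w ∘ next ∘ next ∘ next)))
      ≡⟨ sym (∑-distrib-+₄ w (w ∘ next) (w ∘ next ∘ next) (w ∘ next ∘ next ∘ next)) ⟩
    ∑[ i < suc k ] (w i + (w (next i) + (w (next (next i)) + w (next (next (next i))))))
      ≤⟨ sum-mono-≤ window≤1 ⟩
    ∑[ i < suc k ] 1
      ≡⟨ ∑1≡n (suc k) ⟩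
    suc k ∎
    where
    open ≤-Reasoning
    w : Fin (suc k) → ℕ
    w = outsideEdge b
    rotated₁ : sum (w ∘ next) ≡ e
    rotated₁ = sum-next w
    rotated₂ : sum (w ∘ next ∘ next) ≡ e
    rotated₂ = trans (sum-next (w ∘ next)) rotated₁
    rotated₃ : sum (w ∘ next ∘ next ∘ next) ≡ e
    rotated₃ = trans (sum-next (w ∘ next ∘ next)) rotated₂
    dominated-by-2nd : ∀ i → T (b i ∨ b (next (next i)))
    dominated-by-2nd i = subst (λ y → T (b y ∨ b (next (next i)))) (prev-next i) (dominated (next i))
    window≤1 : ∀ i → w i + (w (next i) + (w (next (next i)) + w (next (next (next i))))) ≤ 1
    window≤1 i = outside-edges-4-apart (b i) (b (next i)) (b (next (next i)))
      (b (next (next (next i)))) (b (next (next (next (next i)))))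
      (dominated-by-2nd i) (dominated-by-2nd (next i)) (dominated-by-2nd (next (next i)))

module _ {n : ℕ} {p : Subset n} {x : Fin n} where

  ∈⇒T-lookup : x ∈ p → T (lookup p x)
  ∈⇒T-lookup x∈p = Equivalence.from T-≡ ([]=⇒lookup x∈p)

  T-lookup⇒∈ : T (lookup p x) → x ∈ p
  T-lookup⇒∈ t = lookup⇒[]= x p (Equivalence.to T-≡ t)

module _ {k : ℕ} {S : Subset (suc k)} (trds : IsKTRDS (Cycle (suc k)) 1 S) where

  1TRDS-dominated : ∀ x → T (lookup S (prev x) ∨ lookup S (next x))
  1TRDS-dominated x with neighboursWith-nonempty⇒ x (_∈? S) (proj₁ trds x)
  ... | inj₁ next∈S = Equivalence.from T-∨ (inj₂ (∈⇒T-lookup next∈S))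
  ... | inj₂ prev∈S = Equivalence.from T-∨ (inj₁ (∈⇒T-lookup prev∈S))

  1TRDS-closed : ∀ x → T (lookup S (prev x) ∧ lookup S (next x)) → T (lookup S x)
  1TRDS-closed x both with x ∈? S
  ... | yes x∈S = ∈⇒T-lookup x∈S
  ... | no  x∉S with Equivalence.to T-∧ both | neighboursWith-nonempty⇒ x (¬? ∘ (_∈? S)) (proj₂ trds x x∉S)
  ... | _ , next∈S | inj₁ next∉S = ⊥-elim (next∉S (T-lookup⇒∈ next∈S))
  ... | prev∈S , _ | inj₂ prev∉S = ⊥-elim (prev∉S (T-lookup⇒∈ prev∈S))

  1TRDS-outsideEdges : ∃[ e ] ∣ S ∣ + (e + e) ≡ suc k × 4 * e ≤ suc k
  1TRDS-outsideEdges = e , trans (cong (_+ (e + e)) (∣p∣≡∑⟦p[i]⟧ S)) (∑⟦b⟧+2*outsideEdges≡n b 1TRDS-dominated 1TRDS-closed)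
                 , 4*outsideEdges≤n b 1TRDS-dominated 1TRDS-closed
    where
    b : Fin (suc k) → Bool
    b = lookup S
    e : ℕ
    e = sum (outsideEdge b)

⌊n/4⌋*2+n%4≤ : ∀ {m} n e → m + (e + e) ≡ n → 4 * e ≤ n → n / 4 * 2 + n % 4 ≤ m
⌊n/4⌋*2+n%4≤ {m} n e m+2e≡n 4e≤n = +-cancelʳ-≤ (e + e) (q * 2 + r) m (begin
  q * 2 + r + (e + e) ≤⟨ +-monoʳ-≤ (q * 2 + r) (+-mono-≤ e≤q e≤q) ⟩
  q * 2 + r + (q + q) ≡⟨ sym n≡ ⟩
  n                   ≡⟨ sym m+2e≡n ⟩
  m + (e + e)         ∎)
  where
  open ≤-Reasoning
  q r : ℕ
  q = n / 4
  r = n % 4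
  e≤q : e ≤ q
  e≤q = subst (_≤ q) (m*n/n≡m e 4) (/-monoˡ-≤ 4 (subst (_≤ n) (*-comm 4 e) 4e≤n))
  regroup : ∀ q r → r + q * 4 ≡ q * 2 + r + (q + q)
  regroup = solve-∀
  n≡ : n ≡ q * 2 + r + (q + q)
  n≡ = trans (m≡m%n+[m/n]*n n 4) (regroup q r)

ceil4-[r+q*4] : ∀ r q → ceil4 (r + q * 4) ≡ (r + 3) / 4 + q
ceil4-[r+q*4] r q = begin
  (r + q * 4 + 3) / 4     ≡⟨ /-congˡ (+-comm-middle r (q * 4) 3) ⟩
  (r + 3 + q * 4) / 4     ≡⟨ +-distrib-/-∣ʳ (r + 3) (divides q refl) ⟩
  (r + 3) / 4 + q * 4 / 4 ≡⟨ cong ((r + 3) / 4 +_) (m*n/n≡m q 4) ⟩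
  (r + 3) / 4 + q         ∎
  where
  open ≡-Reasoning
  +-comm-middle : ∀ a b c → a + b + c ≡ a + c + b
  +-comm-middle = solve-∀

gammaTRCycle-[r+q*4] : ∀ r q → r < 4 → gammaTRCycle (r + q * 4) ≡ q * 2 + r
gammaTRCycle-[r+q*4] 0 q _ with (0 + q * 4) % 4 | [m+kn]%n≡m%n 0 q 4
... | .0 | refl = trans (cong (2 *_) (ceil4-[r+q*4] 0 q)) (case₀ q)
  where
  case₀ : ∀ q → 2 * q ≡ q * 2 + 0
  case₀ = solve-∀
gammaTRCycle-[r+q*4] 1 q _ with (1 + q * 4) % 4 | [m+kn]%n≡m%n 1 q 4
... | .1 | refl = trans (cong (λ c → 2 * c ∸ 1) (ceil4-[r+q*4] 1 q)) (cong (_∸ 1) (case₁ q))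
  where
  case₁ : ∀ q → 2 * (1 + q) ≡ 1 + (q * 2 + 1)
  case₁ = solve-∀
gammaTRCycle-[r+q*4] 2 q _ with (2 + q * 4) % 4 | [m+kn]%n≡m%n 2 q 4
... | .2 | refl = trans (cong (2 *_) (ceil4-[r+q*4] 2 q)) (case₂ q)
  where
  case₂ : ∀ q → 2 * (1 + q) ≡ q * 2 + 2
  case₂ = solve-∀
gammaTRCycle-[r+q*4] 3 q _ with (3 + q * 4) % 4 | [m+kn]%n≡m%n 3 q 4
... | .3 | refl = trans (cong (λ c → 2 * c + 1) (ceil4-[r+q*4] 3 q)) (case₃ q)
  where
  case₃ : ∀ q → 2 * (1 + q) + 1 ≡ q * 2 + 3
  case₃ = solve-∀
gammaTRCycle-[r+q*4] (suc (suc (suc (suc _)))) _ (s≤s (s≤s (s≤s (s≤s ()))))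

gammaTRCycle≡⌊n/4⌋*2+n%4 : ∀ n → gammaTRCycle n ≡ n / 4 * 2 + n % 4
gammaTRCycle≡⌊n/4⌋*2+n%4 n =
  trans (cong gammaTRCycle (m≡m%n+[m/n]*n n 4)) (gammaTRCycle-[r+q*4] (n % 4) (n / 4) (m%n<n n 4))

-- The extremal sets
blocks1100 : ℕ → ℕ → Bool
blocks1100 zero    _                            = true
blocks1100 (suc q) 0                            = true
blocks1100 (suc q) 1                            = true
blocks1100 (suc q) 2                            = false
blocks1100 (suc q) 3                            = false
blocks1100 (suc q) (suc (suc (suc (suc i)))) = blocks1100 q i

blocks1100-0 : ∀ q → T (blocks1100 q 0)
blocks1100-0 zero    = _
blocks1100-0 (suc q) = _

blocks1100-1 : ∀ q → T (blocks1100 q 1)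
blocks1100-1 zero    = _
blocks1100-1 (suc q) = _

blocks1100-dominated : ∀ q i → T (blocks1100 q i ∨ blocks1100 q (2 + i))
blocks1100-dominated zero    _ = _
blocks1100-dominated (suc q) 0 = _
blocks1100-dominated (suc q) 1 = _
blocks1100-dominated (suc q) 2 = Equivalence.from T-∨ (inj₂ (blocks1100-0 q))
blocks1100-dominated (suc q) 3 = Equivalence.from T-∨ (inj₂ (blocks1100-1 q))
blocks1100-dominated (suc q) (suc (suc (suc (suc i)))) = blocks1100-dominated q i

blocks1100-false⇒< : ∀ q i → blocks1100 q i ≡ false → i < q * 4
blocks1100-false⇒< (suc q) 2 _ = s≤s (s≤s (s≤s z≤n))
blocks1100-false⇒< (suc q) 3 _ = s≤s (s≤s (s≤s (s≤s z≤n)))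
blocks1100-false⇒< (suc q) (suc (suc (suc (suc i)))) f = s≤s (s≤s (s≤s (s≤s (blocks1100-false⇒< q i f))))

blocks1100-false-paired : ∀ q i → blocks1100 q i ≡ false →
  blocks1100 q (suc i) ≡ false ⊎ ∃[ j ] i ≡ suc j × blocks1100 q j ≡ false
blocks1100-false-paired (suc q) 2 _ = inj₁ refl
blocks1100-false-paired (suc q) 3 _ = inj₂ (2 , refl , refl)
blocks1100-false-paired (suc q) (suc (suc (suc (suc i)))) f with blocks1100-false-paired q i f
... | inj₁ f′               = inj₁ f′
... | inj₂ (j , refl , f′) = inj₂ (4 + j , refl , f′)

∑-blocks1100 : ∀ q m → ∑[ i < q * 4 + m ] ⟦ blocks1100 q (toℕ i) ⟧ ≡ q * 2 + m
∑-blocks1100 zero    m = ∑1≡n m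
∑-blocks1100 (suc q) m = cong (2 +_) (∑-blocks1100 q m)

blocks1100Subset : ∀ n → ℕ → Subset n
blocks1100Subset n q = tabulate (blocks1100 q ∘ toℕ)

module _ {n : ℕ} (q : ℕ) where

  private
    S : Subset n
    S = blocks1100Subset n q

  ∈-blocks1100Subset : ∀ {y j} → toℕ y ≡ j → T (blocks1100 q j) → y ∈ S
  ∈-blocks1100Subset {y} refl t = T-lookup⇒∈ (subst T (sym (lookup∘tabulate (blocks1100 q ∘ toℕ) y)) t)

  ∉-blocks1100Subset : ∀ {y j} → toℕ y ≡ j → blocks1100 q j ≡ false → y ∉ S
  ∉-blocks1100Subset {y} refl f y∈S =
    subst T (trans (lookup∘tabulate (blocks1100 q ∘ toℕ) y) f) (∈⇒T-lookup y∈S)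

  ∉-blocks1100Subset⁻ : ∀ {y} → y ∉ S → blocks1100 q (toℕ y) ≡ false
  ∉-blocks1100Subset⁻ y∉S = ¬-not (y∉S ∘ ∈-blocks1100Subset refl ∘ Equivalence.from T-≡)

  ∣blocks1100Subset∣ : ∀ {r} → n ≡ q * 4 + r → ∣ S ∣ ≡ q * 2 + r
  ∣blocks1100Subset∣ {r} n≡ = begin
    ∣ S ∣                                      ≡⟨ ∣p∣≡∑⟦p[i]⟧ S ⟩
    ∑[ i < n ] ⟦ lookup S i ⟧                  ≡⟨ sum-cong-≗ {n} {x = ⟦_⟧ ∘ lookup S} (λ i → cong ⟦_⟧ (lookup∘tabulate (blocks1100 q ∘ toℕ) i)) ⟩
    ∑[ i < n ] ⟦ blocks1100 q (toℕ i) ⟧         ≡⟨ cong (λ m → ∑[ i < m ] ⟦ blocks1100 q (toℕ i) ⟧) n≡ ⟩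
    ∑[ i < q * 4 + r ] ⟦ blocks1100 q (toℕ i) ⟧ ≡⟨ ∑-blocks1100 q r ⟩
    q * 2 + r                                  ∎
    where open ≡-Reasoning

module _ {k : ℕ} (q : ℕ) (q*4≤n : q * 4 ≤ 2 + k) where

  private
    S : Subset (2 + k)
    S = blocks1100Subset (2 + k) q

  blocks1100Subset-dominating : ∀ x → 1 ≤ degIn (Cycle (2 + k)) x S
  blocks1100Subset-dominating zero = neighboursWith-nonempty⇐ {1 + k} zero (_∈? S) (cycleAdj-next {1 + k} zero)
    (∈-blocks1100Subset q (toℕ-next-< {1 + k} zero (s≤s (s≤s z≤n))) (blocks1100-1 q))
  blocks1100Subset-dominating x@(suc i) with m≤n⇒m<n∨m≡n (toℕ<n x)
  ... | inj₂ last = neighboursWith-nonempty⇐ x (_∈? S) (cycleAdj-next x)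
    (∈-blocks1100Subset q (toℕ-next-last x last) (blocks1100-0 q))
  ... | inj₁ lt with Equivalence.to T-∨ (blocks1100-dominated q (toℕ i))
  ...   | inj₁ prev∈ = neighboursWith-nonempty⇐ x (_∈? S) (cycleAdj-prev x) (∈-blocks1100Subset q (toℕ-inject₁ i) prev∈)
  ...   | inj₂ next∈ = neighboursWith-nonempty⇐ x (_∈? S) (cycleAdj-next x) (∈-blocks1100Subset q (toℕ-next-< x lt) next∈)

  blocks1100Subset-restrained : ∀ x → x ∉ S → 1 ≤ degOut (Cycle (2 + k)) x S
  blocks1100Subset-restrained x x∉S with blocks1100-false-paired q (toℕ x) (∉-blocks1100Subset⁻ q x∉S)
  ... | inj₁ next∉ = neighboursWith-nonempty⇐ x (¬? ∘ (_∈? S)) (cycleAdj-next x)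
    (∉-blocks1100Subset q (toℕ-next-< x (<-≤-trans (blocks1100-false⇒< q _ next∉) q*4≤n)) next∉)
  ... | inj₂ (j , x≡1+j , prev∉) = neighboursWith-nonempty⇐ x (¬? ∘ (_∈? S)) (cycleAdj-prev x)
    (∉-blocks1100Subset q (toℕ-prev-suc x x≡1+j) prev∉)

  blocks1100Subset-1TRDS : IsKTRDS (Cycle (2 + k)) 1 S
  blocks1100Subset-1TRDS = blocks1100Subset-dominating , blocks1100Subset-restrained

2TRDS-contains-all : ∀ {k} {S : Subset (suc k)} → IsKTRDS (Cycle (suc k)) 2 S → ∀ x → x ∈ S
2TRDS-contains-all {S = S} (dominated , _) x =
  subst (_∈ S) (prev-next x) (neighboursWith-≥2⇒prev (next x) (_∈? S) (dominated (next x)))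

⊤-2TRDS : ∀ {k} → IsKTRDS (Cycle (3 + k)) 2 ⊤
⊤-2TRDS = (λ x → neighboursWith-≥2⇐ x (_∈? ⊤) (next≢prev x) ∈⊤ ∈⊤) , (λ _ x∉⊤ → ⊥-elim (x∉⊤ ∈⊤))

γ×2,t-cycle : ∀ k → IsGammaKTR (Cycle (3 + k)) 2 (3 + k)
γ×2,t-cycle k = (⊤ , ⊤-2TRDS , ∣⊤∣≡n (3 + k))
              , λ S trds → subst (_≤ ∣ S ∣) (∣⊤∣≡n (3 + k)) (p⊆q⇒∣p∣≤∣q∣ {p = ⊤} (λ {x} _ → 2TRDS-contains-all trds x))

γt-cycle : ∀ k → IsGammaKTR (Cycle (2 + k)) 1 (gammaTRCycle (2 + k))
γt-cycle k = (blocks1100Subset n q , blocks1100Subset-1TRDS q (m/n*n≤m n 4) , trans (∣blocks1100Subset∣ q n≡) (sym γ≡))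
           , minimal
  where
  n q r : ℕ
  n = 2 + k
  q = n / 4
  r = n % 4
  n≡ : n ≡ q * 4 + r
  n≡ = trans (m≡m%n+[m/n]*n n 4) (+-comm r (q * 4))
  γ≡ : gammaTRCycle n ≡ q * 2 + r
  γ≡ = gammaTRCycle≡⌊n/4⌋*2+n%4 n
  minimal : ∀ S → IsKTRDS (Cycle n) 1 S → gammaTRCycle n ≤ ∣ S ∣
  minimal S trds = let (e , ∣S∣+2e≡n , 4e≤n) = 1TRDS-outsideEdges trds in
    subst (_≤ ∣ S ∣) (sym γ≡) (⌊n/4⌋*2+n%4≤ n e ∣S∣+2e≡n 4e≤n)

proposition2p4 : (n : ℕ) → (n4 : 4 ≤ n) →
    IsGammaKTR (Cycle n {{nz4 n4}}) 2 n ×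
    IsGammaKTR (Cycle n {{nz4 n4}}) 1 (gammaTRCycle n)
proposition2p4 (suc (suc (suc (suc m)))) (s≤s (s≤s (s≤s (s≤s z≤n)))) = γ×2,t-cycle (suc m) , γt-cycle (suc (suc m))
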